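{- For $t=4$ and $t=6$ there exists a pair of disjoint $3$-MGDD$(5,t)$s.
   Context: A $3$-MGDD$(g,t)$ (modified group divisible design) is a quadruple $(X,\mathcal G,\mathcal H,\mathcal A)$ where $X=\{x_{i,j}:0\le i\le t-1,\,0\le j\le g-1\}$ has $gt$ points, $\mathcal G$ consists of the $t$ groups $G_i=\{x_{i,0},\dots,x_{i,g-1}\}$, $\mathcal H$ consists of the $g$ holes $H_j=\{x_{0,j},\dots,x_{t-1,j}\}$, and $\mathcal A$ is a set of $3$-subsets (blocks) of $X$, each containing at most one point of any group and of any hole, such that every pair of points lying in distinct groups and distinct holes lies in exactly one block. Two $3$-MGDD$(g,t)$s with the same point set, groups and holes are disjoint if their block sets are disjoint. -}

module Defs where

open import Data.Nat using (ℕ)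
open import Data.Fin using (Fin)
open import Data.Product using (Σ; _×_; _,_; proj₁; proj₂; ∃)
open import Data.Sum using (_⊎_)
open import Relation.Binary.PropositionalEquality using (_≡_; _≢_)
open import Relation.Nullary using (¬_)

-- Point x_{i,j} is represented as (i , j) : Fin t × Fin g.
-- Group G_i = points with first coordinate i; hole H_j = points with second coordinate j.
Point : ℕ → ℕ → Set
Point g t = Fin t × Fin g

group : ∀ {g t} → Point g t → Fin t
group = proj₁

hole : ∀ {g t} → Point g t → Fin g
hole = proj₂

Block : ℕ → ℕ → Set
Block g t = Point g t × Point g t × Point g t

_∈B_ : ∀ {g t} → Point g t → Block g t → Set
x ∈B (a , b , c) = x ≡ a ⊎ x ≡ b ⊎ x ≡ c

Separated : ∀ {g t} → Point g t → Point g t → Set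
Separated x y = group x ≢ group y × hole x ≢ hole y

-- each block meets every group and every hole in at most one point
-- (hence its three points are distinct, so it is a 3-subset)
ValidBlock : ∀ {g t} → Block g t → Set
ValidBlock (a , b , c) = Separated a b × Separated a c × Separated b c

SameBlock : ∀ {g t} → Block g t → Block g t → Set
SameBlock B C = ∀ x → (x ∈B B → x ∈B C) × (x ∈B C → x ∈B B)

record MGDD3 (g t : ℕ) : Set where
  field
    n      : ℕ
    blocks : Fin n → Block g t
    valid  : ∀ i → ValidBlock (blocks i)
    covers : ∀ x y → Separated x y →
             ∃ λ i → x ∈B blocks i × y ∈B blocks i
    unique : ∀ x y → Separated x y → ∀ i j →
             x ∈B blocks i → y ∈B blocks i →
             x ∈B blocks j → y ∈B blocks j → i ≡ j

Disjoint : ∀ {g t} → MGDD3 g t → MGDD3 g t → Set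
Disjoint D E = ∀ i j → ¬ SameBlock (MGDD3.blocks D i) (MGDD3.blocks E j)

DisjointPair : ℕ → ℕ → Set
DisjointPair g t = Σ (MGDD3 g t) λ D → Σ (MGDD3 g t) λ E → Disjoint D E

-- Both pairs of designs are listed explicitly, and every defining property is
-- checked by exhaustive computation.  Uniqueness of the block through a
-- separated pair reduces to no two distinct blocks having two points in
-- common, and disjointness to no block of one design lying inside a block of
-- the other, since blocks that are equal as sets contain each other.

module Submission where

open import Defs
open import Data.Nat using (ℕ; s<s)
open import Data.Fin using (#_; zero; suc; _<_)
open import Data.Fin.Properties using (all?; <-cmp) renaming (_≟_ to _≟ᶠ_)
open import Data.Product using (_×_; _,_; proj₁; ∃; uncurry; curry)
open import Data.Product.Properties using (≡-dec)
open import Data.Sum using (_⊎_; inj₁; inj₂)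
open import Data.List as List using (List)
import Data.List.Relation.Unary.Any as ListAny
open import Data.Vec using (Vec; _∷_; []; lookup; toList)
import Data.Vec.Relation.Unary.All as All
open import Data.Vec.Relation.Unary.All.Properties using (lookup⁺)
open import Data.Vec.Relation.Unary.AllPairs as AllPairs using (AllPairs; _∷_)
open import Data.Vec.Relation.Unary.Any as Any using (Any)
open import Data.Vec.Relation.Unary.Any.Properties using (lookup-index)
open import Relation.Binary using (DecidableEquality; Decidable; Rel; tri<; tri≈; tri>)
open import Relation.Binary.PropositionalEquality using (_≡_; _≢_; refl)
open import Relation.Nullary using (Dec; yes; no; ¬_; contradiction)
open import Relation.Nullary.Decidable using (True; toWitness; map′; ¬?; _×-dec_; _⊎-dec_; _→-dec_)
open import Relation.Unary using (Pred) renaming (Decidable to Decidable₁)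

AllPairs-lookup : ∀ {a r} {A : Set a} {R : Rel A r} {n} {xs : Vec A n} →
                  AllPairs R xs → ∀ {i j} → i < j → R (lookup xs i) (lookup xs j)
AllPairs-lookup (rx ∷ _)  {zero}  {suc j} _       = lookup⁺ rx j
AllPairs-lookup (_ ∷ rxs) {suc i} {suc j} (s<s i<j) = AllPairs-lookup rxs i<j

Any-filter⁻ : ∀ {a p q} {A : Set a} {P : Pred A p} {Q : Pred A q} (Q? : Decidable₁ Q) {n} (xs : Vec A n) →
              ListAny.Any P (List.filter Q? (toList xs)) → Any (λ x → Q x × P x) xs
Any-filter⁻ Q? (x ∷ xs) p with Q? x | p
... | yes qx | ListAny.here px = Any.here (qx , px)
... | yes _  | ListAny.there p = Any.there (Any-filter⁻ Q? xs p)
... | no  _  | p               = Any.there (Any-filter⁻ Q? xs p)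

module _ {g t : ℕ} where

  _≟ₚ_ : DecidableEquality (Point g t)
  _≟ₚ_ = ≡-dec _≟ᶠ_ _≟ᶠ_

  all-points? : {P : Point g t → Set} → (∀ x → Dec (P x)) → Dec (∀ x → P x)
  all-points? P? = map′ uncurry curry (all? λ i → all? λ j → P? (i , j))

  _∈B?_ : Decidable (_∈B_ {g} {t})
  x ∈B? (a , b , c) = x ≟ₚ a ⊎-dec x ≟ₚ b ⊎-dec x ≟ₚ c

  separated? : Decidable (Separated {g} {t})
  separated? x y = ¬? (group x ≟ᶠ group y) ×-dec ¬? (hole x ≟ᶠ hole y)

  validBlock? : (B : Block g t) → Dec (ValidBlock B)
  validBlock? (a , b , c) = separated? a b ×-dec separated? a c ×-dec separated? b c

  separated⇒≢ : ∀ {x y : Point g t} → Separated x y → x ≢ y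
  separated⇒≢ (group≢ , _) refl = group≢ refl

  SharePair : Block g t → Block g t → Set
  SharePair (a , b , c) C = (a ∈B C × (b ∈B C ⊎ c ∈B C)) ⊎ (b ∈B C × c ∈B C)

  sharePair? : Decidable SharePair
  sharePair? (a , b , c) C =
    (a ∈B? C ×-dec (b ∈B? C ⊎-dec c ∈B? C)) ⊎-dec (b ∈B? C ×-dec c ∈B? C)

  common-pair⇒SharePair : ∀ {x y} B C → x ≢ y →
                          x ∈B B → y ∈B B → x ∈B C → y ∈B C → SharePair B C
  common-pair⇒SharePair B C x≢y (inj₁ refl)        (inj₁ refl)        _  _  = contradiction refl x≢y
  common-pair⇒SharePair B C x≢y (inj₂ (inj₁ refl)) (inj₂ (inj₁ refl)) _  _  = contradiction refl x≢y
  common-pair⇒SharePair B C x≢y (inj₂ (inj₂ refl)) (inj₂ (inj₂ refl)) _  _  = contradiction refl x≢y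
  common-pair⇒SharePair B C _   (inj₁ refl)        (inj₂ (inj₁ refl)) xC yC = inj₁ (xC , inj₁ yC)
  common-pair⇒SharePair B C _   (inj₂ (inj₁ refl)) (inj₁ refl)        xC yC = inj₁ (yC , inj₁ xC)
  common-pair⇒SharePair B C _   (inj₁ refl)        (inj₂ (inj₂ refl)) xC yC = inj₁ (xC , inj₂ yC)
  common-pair⇒SharePair B C _   (inj₂ (inj₂ refl)) (inj₁ refl)        xC yC = inj₁ (yC , inj₂ xC)
  common-pair⇒SharePair B C _   (inj₂ (inj₁ refl)) (inj₂ (inj₂ refl)) xC yC = inj₂ (xC , yC)
  common-pair⇒SharePair B C _   (inj₂ (inj₂ refl)) (inj₂ (inj₁ refl)) xC yC = inj₂ (yC , xC)

  _⊆B_ : Block g t → Block g t → Set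
  (a , b , c) ⊆B C = a ∈B C × b ∈B C × c ∈B C

  _⊆B?_ : Decidable _⊆B_
  (a , b , c) ⊆B? C = a ∈B? C ×-dec b ∈B? C ×-dec c ∈B? C

  SameBlock⇒⊆B : ∀ B C → SameBlock B C → B ⊆B C
  SameBlock⇒⊆B (a , b , c) C same =
    proj₁ (same a) (inj₁ refl) , proj₁ (same b) (inj₂ (inj₁ refl)) , proj₁ (same c) (inj₂ (inj₂ refl))

  module _ {n : ℕ} (blocks : Vec (Block g t) n) where

    -- The blocks through x are passed to coveredBy? as an argument, so that
    -- they are filtered once per point rather than once per pair.
    blocksThrough : Point g t → List (Block g t)
    blocksThrough x = List.filter (x ∈B?_) (toList blocks)

    CoveredBy : Point g t → List (Block g t) → Set
    CoveredBy x through = ∀ y → Separated x y → ListAny.Any (y ∈B_) through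

    coveredBy? : ∀ x through → Dec (CoveredBy x through)
    coveredBy? x through = all-points? λ y → separated? x y →-dec ListAny.any? (y ∈B?_) through

    Covering : Set
    Covering = ∀ x → CoveredBy x (blocksThrough x)

    covering? : Dec Covering
    covering? = all-points? λ x → coveredBy? x (blocksThrough x)

    covering⇒covers : Covering → ∀ x y → Separated x y →
                      ∃ λ i → x ∈B lookup blocks i × y ∈B lookup blocks i
    covering⇒covers covering x y sep = Any.index p , lookup-index p
      where p = Any-filter⁻ (x ∈B?_) blocks (covering x y sep)

    NoRepeatedPair : Set
    NoRepeatedPair = AllPairs (λ B C → ¬ SharePair B C) blocks

    noRepeatedPair? : Dec NoRepeatedPair
    noRepeatedPair? = AllPairs.allPairs? (λ B C → ¬? (sharePair? B C)) blocks

    noRepeatedPair⇒unique : NoRepeatedPair → ∀ x y → Separated x y → ∀ i j →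
                            x ∈B lookup blocks i → y ∈B lookup blocks i →
                            x ∈B lookup blocks j → y ∈B lookup blocks j → i ≡ j
    noRepeatedPair⇒unique noRepeated x y sep i j xi yi xj yj with <-cmp i j
    ... | tri< i<j _ _ = contradiction (common-pair⇒SharePair _ _ (separated⇒≢ sep) xi yi xj yj)
                                       (AllPairs-lookup noRepeated i<j)
    ... | tri≈ _ i≡j _ = i≡j
    ... | tri> _ _ j<i = contradiction (common-pair⇒SharePair _ _ (separated⇒≢ sep) xj yj xi yi)
                                       (AllPairs-lookup noRepeated j<i)

  fromBlocks : ∀ {n} (blocks : Vec (Block g t) n) →
               {True (All.all? validBlock? blocks)} → {True (covering? blocks)} →
               {True (noRepeatedPair? blocks)} → MGDD3 g t
  fromBlocks {n} blocks {valid} {covering} {noRepeated} = record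
    { n      = n
    ; blocks = lookup blocks
    ; valid  = lookup⁺ (toWitness valid)
    ; covers = covering⇒covers blocks (toWitness covering)
    ; unique = noRepeatedPair⇒unique blocks (toWitness noRepeated)
    }

  disjoint : ∀ {n m} (Ds : Vec (Block g t) n) (Es : Vec (Block g t) m) →
             {True (All.all? (λ D → All.all? (λ E → ¬? (D ⊆B? E)) Es) Ds)} →
             ∀ i j → ¬ SameBlock (lookup Ds i) (lookup Es j)
  disjoint Ds Es {nested} i j same =
    lookup⁺ (lookup⁺ (toWitness nested) i) j (SameBlock⇒⊆B (lookup Ds i) (lookup Es j) same)

D₄-blocks : Vec (Block 5 4) 40
D₄-blocks =
    ((# 2 , # 1) , (# 3 , # 4) , (# 1 , # 2)) ∷ ((# 0 , # 3) , (# 3 , # 4) , (# 1 , # 0)) ∷ ((# 0 , # 3) , (# 2 , # 1) , (# 3 , # 2)) ∷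
    ((# 1 , # 0) , (# 2 , # 1) , (# 0 , # 4)) ∷ ((# 3 , # 3) , (# 2 , # 1) , (# 1 , # 4)) ∷ ((# 2 , # 1) , (# 0 , # 0) , (# 1 , # 3)) ∷
    ((# 0 , # 2) , (# 2 , # 1) , (# 3 , # 0)) ∷ ((# 1 , # 0) , (# 2 , # 2) , (# 3 , # 3)) ∷ ((# 0 , # 1) , (# 1 , # 0) , (# 2 , # 4)) ∷
    ((# 1 , # 0) , (# 3 , # 2) , (# 2 , # 3)) ∷ ((# 1 , # 0) , (# 0 , # 2) , (# 3 , # 1)) ∷ ((# 0 , # 1) , (# 3 , # 3) , (# 1 , # 2)) ∷
    ((# 3 , # 3) , (# 0 , # 4) , (# 2 , # 0)) ∷ ((# 1 , # 2) , (# 2 , # 0) , (# 0 , # 3)) ∷ ((# 0 , # 2) , (# 3 , # 3) , (# 2 , # 4)) ∷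
    ((# 1 , # 1) , (# 3 , # 3) , (# 0 , # 0)) ∷ ((# 0 , # 2) , (# 1 , # 3) , (# 3 , # 4)) ∷ ((# 3 , # 2) , (# 0 , # 0) , (# 2 , # 4)) ∷
    ((# 2 , # 4) , (# 1 , # 2) , (# 3 , # 1)) ∷ ((# 1 , # 2) , (# 0 , # 0) , (# 2 , # 3)) ∷ ((# 1 , # 2) , (# 0 , # 4) , (# 3 , # 0)) ∷
    ((# 2 , # 4) , (# 1 , # 3) , (# 3 , # 0)) ∷ ((# 1 , # 1) , (# 2 , # 4) , (# 0 , # 3)) ∷ ((# 3 , # 4) , (# 0 , # 0) , (# 2 , # 2)) ∷
    ((# 1 , # 4) , (# 0 , # 0) , (# 3 , # 1)) ∷ ((# 3 , # 1) , (# 0 , # 3) , (# 2 , # 2)) ∷ ((# 0 , # 3) , (# 3 , # 0) , (# 1 , # 4)) ∷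
    ((# 1 , # 4) , (# 2 , # 2) , (# 0 , # 1)) ∷ ((# 0 , # 1) , (# 3 , # 0) , (# 2 , # 3)) ∷ ((# 0 , # 1) , (# 3 , # 4) , (# 2 , # 0)) ∷
    ((# 2 , # 3) , (# 3 , # 4) , (# 1 , # 1)) ∷ ((# 1 , # 3) , (# 2 , # 2) , (# 0 , # 4)) ∷ ((# 1 , # 1) , (# 2 , # 2) , (# 3 , # 0)) ∷
    ((# 2 , # 3) , (# 1 , # 4) , (# 0 , # 2)) ∷ ((# 3 , # 1) , (# 0 , # 4) , (# 2 , # 3)) ∷ ((# 2 , # 0) , (# 1 , # 4) , (# 3 , # 2)) ∷
    ((# 3 , # 2) , (# 1 , # 3) , (# 0 , # 1)) ∷ ((# 1 , # 1) , (# 2 , # 0) , (# 0 , # 2)) ∷ ((# 1 , # 1) , (# 3 , # 2) , (# 0 , # 4)) ∷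
    ((# 3 , # 1) , (# 2 , # 0) , (# 1 , # 3)) ∷
    []

E₄-blocks : Vec (Block 5 4) 40
E₄-blocks =
    ((# 2 , # 1) , (# 3 , # 4) , (# 0 , # 0)) ∷ ((# 1 , # 2) , (# 0 , # 0) , (# 3 , # 3)) ∷ ((# 2 , # 4) , (# 1 , # 2) , (# 3 , # 0)) ∷
    ((# 1 , # 2) , (# 2 , # 1) , (# 0 , # 3)) ∷ ((# 0 , # 3) , (# 3 , # 0) , (# 1 , # 1)) ∷ ((# 0 , # 3) , (# 3 , # 4) , (# 2 , # 2)) ∷
    ((# 1 , # 1) , (# 3 , # 4) , (# 0 , # 2)) ∷ ((# 1 , # 0) , (# 3 , # 4) , (# 2 , # 3)) ∷ ((# 0 , # 1) , (# 3 , # 4) , (# 1 , # 2)) ∷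
    ((# 1 , # 3) , (# 3 , # 4) , (# 2 , # 0)) ∷ ((# 1 , # 2) , (# 2 , # 0) , (# 0 , # 4)) ∷ ((# 3 , # 1) , (# 1 , # 2) , (# 2 , # 3)) ∷
    ((# 2 , # 3) , (# 0 , # 2) , (# 3 , # 0)) ∷ ((# 1 , # 1) , (# 2 , # 0) , (# 3 , # 2)) ∷ ((# 1 , # 1) , (# 2 , # 4) , (# 3 , # 3)) ∷
    ((# 1 , # 1) , (# 2 , # 2) , (# 0 , # 0)) ∷ ((# 2 , # 3) , (# 1 , # 1) , (# 0 , # 4)) ∷ ((# 1 , # 4) , (# 0 , # 0) , (# 2 , # 3)) ∷
    ((# 2 , # 3) , (# 3 , # 2) , (# 0 , # 1)) ∷ ((# 0 , # 1) , (# 2 , # 4) , (# 1 , # 3)) ∷ ((# 3 , # 2) , (# 0 , # 0) , (# 1 , # 3)) ∷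
    ((# 2 , # 4) , (# 0 , # 0) , (# 3 , # 1)) ∷ ((# 0 , # 2) , (# 2 , # 4) , (# 1 , # 0)) ∷ ((# 2 , # 4) , (# 0 , # 3) , (# 3 , # 2)) ∷
    ((# 1 , # 0) , (# 0 , # 3) , (# 3 , # 1)) ∷ ((# 0 , # 3) , (# 2 , # 0) , (# 1 , # 4)) ∷ ((# 0 , # 1) , (# 2 , # 0) , (# 3 , # 3)) ∷
    ((# 0 , # 1) , (# 1 , # 0) , (# 2 , # 2)) ∷ ((# 0 , # 1) , (# 3 , # 0) , (# 1 , # 4)) ∷ ((# 0 , # 2) , (# 2 , # 0) , (# 3 , # 1)) ∷
    ((# 0 , # 2) , (# 1 , # 3) , (# 2 , # 1)) ∷ ((# 0 , # 2) , (# 3 , # 3) , (# 1 , # 4)) ∷ ((# 1 , # 4) , (# 2 , # 2) , (# 3 , # 1)) ∷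
    ((# 1 , # 3) , (# 2 , # 2) , (# 3 , # 0)) ∷ ((# 0 , # 4) , (# 2 , # 2) , (# 3 , # 3)) ∷ ((# 1 , # 0) , (# 3 , # 3) , (# 2 , # 1)) ∷
    ((# 0 , # 4) , (# 3 , # 0) , (# 2 , # 1)) ∷ ((# 3 , # 2) , (# 2 , # 1) , (# 1 , # 4)) ∷ ((# 1 , # 3) , (# 0 , # 4) , (# 3 , # 1)) ∷
    ((# 3 , # 2) , (# 0 , # 4) , (# 1 , # 0)) ∷
    []

D₆-blocks : Vec (Block 5 6) 100
D₆-blocks =
    ((# 2 , # 1) , (# 3 , # 4) , (# 0 , # 2)) ∷ ((# 4 , # 0) , (# 2 , # 1) , (# 3 , # 3)) ∷ ((# 2 , # 1) , (# 5 , # 2) , (# 4 , # 3)) ∷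
    ((# 1 , # 0) , (# 2 , # 1) , (# 0 , # 3)) ∷ ((# 5 , # 4) , (# 2 , # 1) , (# 1 , # 2)) ∷ ((# 5 , # 0) , (# 2 , # 1) , (# 4 , # 2)) ∷
    ((# 0 , # 4) , (# 2 , # 1) , (# 5 , # 3)) ∷ ((# 2 , # 1) , (# 1 , # 4) , (# 3 , # 0)) ∷ ((# 3 , # 2) , (# 2 , # 1) , (# 1 , # 3)) ∷
    ((# 2 , # 1) , (# 0 , # 0) , (# 4 , # 4)) ∷ ((# 5 , # 0) , (# 1 , # 3) , (# 4 , # 1)) ∷ ((# 5 , # 0) , (# 3 , # 4) , (# 4 , # 3)) ∷
    ((# 5 , # 0) , (# 0 , # 4) , (# 1 , # 2)) ∷ ((# 3 , # 2) , (# 5 , # 0) , (# 1 , # 4)) ∷ ((# 0 , # 3) , (# 5 , # 0) , (# 2 , # 4)) ∷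
    ((# 3 , # 1) , (# 5 , # 0) , (# 2 , # 2)) ∷ ((# 0 , # 1) , (# 5 , # 0) , (# 3 , # 3)) ∷ ((# 0 , # 2) , (# 5 , # 0) , (# 1 , # 1)) ∷
    ((# 4 , # 4) , (# 5 , # 0) , (# 2 , # 3)) ∷ ((# 1 , # 2) , (# 3 , # 3) , (# 2 , # 0)) ∷ ((# 4 , # 4) , (# 1 , # 2) , (# 3 , # 1)) ∷
    ((# 1 , # 2) , (# 4 , # 3) , (# 0 , # 1)) ∷ ((# 1 , # 2) , (# 0 , # 3) , (# 3 , # 0)) ∷ ((# 2 , # 4) , (# 1 , # 2) , (# 0 , # 0)) ∷
    ((# 1 , # 2) , (# 5 , # 1) , (# 4 , # 0)) ∷ ((# 5 , # 3) , (# 1 , # 2) , (# 4 , # 1)) ∷ ((# 1 , # 2) , (# 3 , # 4) , (# 2 , # 3)) ∷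
    ((# 4 , # 4) , (# 0 , # 3) , (# 2 , # 0)) ∷ ((# 0 , # 3) , (# 5 , # 1) , (# 2 , # 2)) ∷ ((# 3 , # 2) , (# 0 , # 3) , (# 5 , # 4)) ∷
    ((# 0 , # 3) , (# 4 , # 1) , (# 5 , # 2)) ∷ ((# 1 , # 1) , (# 0 , # 3) , (# 4 , # 0)) ∷ ((# 0 , # 3) , (# 3 , # 4) , (# 4 , # 2)) ∷
    ((# 3 , # 1) , (# 0 , # 3) , (# 1 , # 4)) ∷ ((# 4 , # 1) , (# 3 , # 4) , (# 2 , # 2)) ∷ ((# 1 , # 0) , (# 3 , # 4) , (# 5 , # 1)) ∷
    ((# 4 , # 0) , (# 3 , # 4) , (# 5 , # 2)) ∷ ((# 0 , # 1) , (# 3 , # 4) , (# 5 , # 3)) ∷ ((# 3 , # 4) , (# 0 , # 0) , (# 1 , # 3)) ∷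
    ((# 1 , # 1) , (# 3 , # 4) , (# 2 , # 0)) ∷ ((# 4 , # 1) , (# 3 , # 0) , (# 0 , # 4)) ∷ ((# 2 , # 0) , (# 4 , # 1) , (# 3 , # 2)) ∷
    ((# 2 , # 4) , (# 4 , # 1) , (# 1 , # 0)) ∷ ((# 0 , # 2) , (# 4 , # 1) , (# 5 , # 4)) ∷ ((# 3 , # 3) , (# 4 , # 1) , (# 1 , # 4)) ∷
    ((# 2 , # 3) , (# 4 , # 1) , (# 0 , # 0)) ∷ ((# 5 , # 3) , (# 2 , # 0) , (# 1 , # 4)) ∷ ((# 1 , # 4) , (# 5 , # 2) , (# 2 , # 3)) ∷
    ((# 0 , # 1) , (# 1 , # 4) , (# 2 , # 2)) ∷ ((# 4 , # 0) , (# 1 , # 4) , (# 0 , # 2)) ∷ ((# 1 , # 4) , (# 4 , # 3) , (# 5 , # 1)) ∷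
    ((# 1 , # 4) , (# 0 , # 0) , (# 4 , # 2)) ∷ ((# 5 , # 1) , (# 0 , # 0) , (# 3 , # 3)) ∷ ((# 5 , # 2) , (# 0 , # 0) , (# 1 , # 1)) ∷
    ((# 3 , # 2) , (# 0 , # 0) , (# 5 , # 3)) ∷ ((# 2 , # 2) , (# 0 , # 0) , (# 5 , # 4)) ∷ ((# 4 , # 3) , (# 0 , # 0) , (# 3 , # 1)) ∷
    ((# 2 , # 0) , (# 4 , # 3) , (# 0 , # 2)) ∷ ((# 2 , # 0) , (# 5 , # 1) , (# 4 , # 2)) ∷ ((# 5 , # 4) , (# 2 , # 0) , (# 0 , # 1)) ∷
    ((# 5 , # 4) , (# 3 , # 3) , (# 1 , # 1)) ∷ ((# 5 , # 4) , (# 4 , # 3) , (# 3 , # 0)) ∷ ((# 2 , # 4) , (# 4 , # 3) , (# 3 , # 2)) ∷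
    ((# 1 , # 0) , (# 4 , # 3) , (# 2 , # 2)) ∷ ((# 1 , # 1) , (# 4 , # 3) , (# 0 , # 4)) ∷ ((# 1 , # 1) , (# 3 , # 2) , (# 4 , # 4)) ∷
    ((# 1 , # 1) , (# 2 , # 2) , (# 3 , # 0)) ∷ ((# 2 , # 3) , (# 1 , # 1) , (# 4 , # 2)) ∷ ((# 1 , # 1) , (# 2 , # 4) , (# 5 , # 3)) ∷
    ((# 3 , # 3) , (# 2 , # 2) , (# 0 , # 4)) ∷ ((# 1 , # 3) , (# 2 , # 2) , (# 4 , # 4)) ∷ ((# 4 , # 0) , (# 2 , # 2) , (# 5 , # 3)) ∷
    ((# 4 , # 4) , (# 5 , # 1) , (# 0 , # 2)) ∷ ((# 2 , # 4) , (# 5 , # 1) , (# 3 , # 0)) ∷ ((# 1 , # 3) , (# 5 , # 1) , (# 0 , # 4)) ∷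
    ((# 3 , # 2) , (# 5 , # 1) , (# 2 , # 3)) ∷ ((# 3 , # 2) , (# 4 , # 0) , (# 0 , # 4)) ∷ ((# 0 , # 1) , (# 3 , # 2) , (# 1 , # 0)) ∷
    ((# 4 , # 4) , (# 5 , # 3) , (# 1 , # 0)) ∷ ((# 4 , # 4) , (# 3 , # 3) , (# 5 , # 2)) ∷ ((# 0 , # 1) , (# 4 , # 4) , (# 3 , # 0)) ∷
    ((# 5 , # 2) , (# 3 , # 0) , (# 1 , # 3)) ∷ ((# 0 , # 1) , (# 2 , # 3) , (# 4 , # 0)) ∷ ((# 2 , # 0) , (# 1 , # 3) , (# 3 , # 1)) ∷
    ((# 0 , # 2) , (# 1 , # 3) , (# 2 , # 4)) ∷ ((# 4 , # 0) , (# 1 , # 3) , (# 5 , # 4)) ∷ ((# 0 , # 2) , (# 3 , # 3) , (# 1 , # 0)) ∷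
    ((# 3 , # 1) , (# 4 , # 0) , (# 2 , # 4)) ∷ ((# 1 , # 3) , (# 4 , # 2) , (# 0 , # 1)) ∷ ((# 0 , # 1) , (# 2 , # 4) , (# 5 , # 2)) ∷
    ((# 3 , # 3) , (# 4 , # 2) , (# 2 , # 4)) ∷ ((# 2 , # 0) , (# 0 , # 4) , (# 5 , # 2)) ∷ ((# 3 , # 1) , (# 5 , # 2) , (# 1 , # 0)) ∷
    ((# 2 , # 3) , (# 3 , # 0) , (# 0 , # 2)) ∷ ((# 3 , # 1) , (# 0 , # 2) , (# 5 , # 3)) ∷ ((# 5 , # 3) , (# 3 , # 0) , (# 4 , # 2)) ∷
    ((# 1 , # 0) , (# 2 , # 3) , (# 0 , # 4)) ∷ ((# 3 , # 1) , (# 0 , # 4) , (# 4 , # 2)) ∷ ((# 5 , # 4) , (# 4 , # 2) , (# 1 , # 0)) ∷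
    ((# 2 , # 3) , (# 3 , # 1) , (# 5 , # 4)) ∷
    []

E₆-blocks : Vec (Block 5 6) 100
E₆-blocks =
    ((# 2 , # 1) , (# 3 , # 4) , (# 0 , # 3)) ∷ ((# 2 , # 1) , (# 5 , # 2) , (# 3 , # 3)) ∷ ((# 4 , # 0) , (# 2 , # 1) , (# 0 , # 2)) ∷
    ((# 2 , # 1) , (# 1 , # 4) , (# 3 , # 2)) ∷ ((# 5 , # 0) , (# 2 , # 1) , (# 0 , # 4)) ∷ ((# 2 , # 1) , (# 4 , # 3) , (# 5 , # 4)) ∷
    ((# 1 , # 0) , (# 2 , # 1) , (# 4 , # 2)) ∷ ((# 1 , # 3) , (# 2 , # 1) , (# 3 , # 0)) ∷ ((# 2 , # 1) , (# 0 , # 0) , (# 1 , # 2)) ∷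
    ((# 5 , # 3) , (# 2 , # 1) , (# 4 , # 4)) ∷ ((# 0 , # 2) , (# 1 , # 3) , (# 3 , # 1)) ∷ ((# 0 , # 2) , (# 5 , # 4) , (# 3 , # 3)) ∷
    ((# 4 , # 4) , (# 0 , # 2) , (# 5 , # 0)) ∷ ((# 5 , # 0) , (# 1 , # 3) , (# 2 , # 2)) ∷ ((# 1 , # 3) , (# 0 , # 4) , (# 4 , # 1)) ∷
    ((# 5 , # 4) , (# 1 , # 3) , (# 4 , # 2)) ∷ ((# 1 , # 3) , (# 0 , # 0) , (# 4 , # 4)) ∷ ((# 3 , # 2) , (# 1 , # 3) , (# 0 , # 1)) ∷
    ((# 2 , # 4) , (# 1 , # 3) , (# 5 , # 1)) ∷ ((# 4 , # 0) , (# 1 , # 3) , (# 5 , # 2)) ∷ ((# 2 , # 0) , (# 1 , # 3) , (# 3 , # 4)) ∷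
    ((# 4 , # 4) , (# 3 , # 2) , (# 1 , # 0)) ∷ ((# 3 , # 1) , (# 4 , # 4) , (# 5 , # 2)) ∷ ((# 4 , # 4) , (# 0 , # 3) , (# 5 , # 1)) ∷
    ((# 2 , # 3) , (# 4 , # 4) , (# 3 , # 0)) ∷ ((# 4 , # 4) , (# 2 , # 2) , (# 3 , # 3)) ∷ ((# 4 , # 4) , (# 1 , # 1) , (# 2 , # 0)) ∷
    ((# 0 , # 1) , (# 4 , # 4) , (# 1 , # 2)) ∷ ((# 0 , # 2) , (# 2 , # 0) , (# 5 , # 1)) ∷ ((# 3 , # 2) , (# 5 , # 1) , (# 0 , # 4)) ∷
    ((# 3 , # 2) , (# 4 , # 3) , (# 5 , # 0)) ∷ ((# 3 , # 2) , (# 2 , # 0) , (# 5 , # 3)) ∷ ((# 5 , # 4) , (# 2 , # 0) , (# 1 , # 2)) ∷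
    ((# 3 , # 2) , (# 0 , # 3) , (# 2 , # 4)) ∷ ((# 3 , # 2) , (# 4 , # 0) , (# 1 , # 1)) ∷ ((# 3 , # 2) , (# 4 , # 1) , (# 0 , # 0)) ∷
    ((# 2 , # 3) , (# 3 , # 2) , (# 5 , # 4)) ∷ ((# 5 , # 4) , (# 0 , # 0) , (# 3 , # 1)) ∷ ((# 5 , # 4) , (# 4 , # 0) , (# 0 , # 1)) ∷
    ((# 1 , # 0) , (# 5 , # 4) , (# 2 , # 2)) ∷ ((# 5 , # 4) , (# 4 , # 1) , (# 3 , # 0)) ∷ ((# 5 , # 4) , (# 0 , # 3) , (# 1 , # 1)) ∷
    ((# 1 , # 0) , (# 0 , # 3) , (# 4 , # 1)) ∷ ((# 4 , # 1) , (# 2 , # 2) , (# 1 , # 4)) ∷ ((# 2 , # 0) , (# 4 , # 1) , (# 5 , # 2)) ∷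
    ((# 0 , # 3) , (# 5 , # 2) , (# 1 , # 4)) ∷ ((# 0 , # 3) , (# 2 , # 0) , (# 4 , # 2)) ∷ ((# 0 , # 3) , (# 3 , # 0) , (# 2 , # 2)) ∷
    ((# 4 , # 0) , (# 0 , # 3) , (# 3 , # 1)) ∷ ((# 0 , # 3) , (# 5 , # 0) , (# 1 , # 2)) ∷ ((# 5 , # 3) , (# 4 , # 1) , (# 0 , # 2)) ∷
    ((# 4 , # 1) , (# 3 , # 4) , (# 5 , # 0)) ∷ ((# 2 , # 3) , (# 4 , # 1) , (# 1 , # 2)) ∷ ((# 3 , # 3) , (# 4 , # 1) , (# 2 , # 4)) ∷
    ((# 2 , # 4) , (# 4 , # 0) , (# 1 , # 2)) ∷ ((# 1 , # 2) , (# 3 , # 3) , (# 5 , # 1)) ∷ ((# 1 , # 0) , (# 3 , # 3) , (# 0 , # 1)) ∷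
    ((# 0 , # 1) , (# 2 , # 0) , (# 4 , # 3)) ∷ ((# 2 , # 0) , (# 1 , # 4) , (# 3 , # 3)) ∷ ((# 3 , # 1) , (# 2 , # 0) , (# 0 , # 4)) ∷
    ((# 4 , # 0) , (# 3 , # 3) , (# 0 , # 4)) ∷ ((# 3 , # 3) , (# 5 , # 0) , (# 4 , # 2)) ∷ ((# 1 , # 1) , (# 3 , # 3) , (# 0 , # 0)) ∷
    ((# 4 , # 0) , (# 2 , # 2) , (# 5 , # 1)) ∷ ((# 4 , # 0) , (# 3 , # 4) , (# 5 , # 3)) ∷ ((# 2 , # 3) , (# 4 , # 0) , (# 1 , # 4)) ∷
    ((# 1 , # 2) , (# 3 , # 4) , (# 4 , # 3)) ∷ ((# 3 , # 1) , (# 1 , # 2) , (# 5 , # 3)) ∷ ((# 1 , # 2) , (# 0 , # 4) , (# 3 , # 0)) ∷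
    ((# 3 , # 1) , (# 2 , # 2) , (# 4 , # 3)) ∷ ((# 0 , # 0) , (# 2 , # 2) , (# 5 , # 3)) ∷ ((# 0 , # 4) , (# 2 , # 2) , (# 1 , # 1)) ∷
    ((# 3 , # 4) , (# 2 , # 2) , (# 0 , # 1)) ∷ ((# 5 , # 3) , (# 0 , # 4) , (# 1 , # 0)) ∷ ((# 0 , # 4) , (# 4 , # 3) , (# 5 , # 2)) ∷
    ((# 2 , # 3) , (# 0 , # 4) , (# 4 , # 2)) ∷ ((# 1 , # 4) , (# 0 , # 0) , (# 5 , # 1)) ∷ ((# 4 , # 3) , (# 0 , # 0) , (# 2 , # 4)) ∷
    ((# 4 , # 2) , (# 0 , # 0) , (# 3 , # 4)) ∷ ((# 2 , # 3) , (# 0 , # 0) , (# 5 , # 2)) ∷ ((# 0 , # 1) , (# 2 , # 3) , (# 5 , # 0)) ∷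
    ((# 3 , # 1) , (# 2 , # 3) , (# 1 , # 0)) ∷ ((# 1 , # 1) , (# 5 , # 0) , (# 2 , # 4)) ∷ ((# 3 , # 1) , (# 5 , # 0) , (# 1 , # 4)) ∷
    ((# 3 , # 1) , (# 2 , # 4) , (# 4 , # 2)) ∷ ((# 5 , # 1) , (# 4 , # 2) , (# 3 , # 0)) ∷ ((# 1 , # 1) , (# 4 , # 2) , (# 5 , # 3)) ∷
    ((# 0 , # 1) , (# 4 , # 2) , (# 1 , # 4)) ∷ ((# 5 , # 3) , (# 1 , # 4) , (# 3 , # 0)) ∷ ((# 5 , # 3) , (# 2 , # 4) , (# 0 , # 1)) ∷
    ((# 0 , # 1) , (# 3 , # 0) , (# 5 , # 2)) ∷ ((# 1 , # 1) , (# 5 , # 2) , (# 3 , # 4)) ∷ ((# 1 , # 0) , (# 3 , # 4) , (# 0 , # 2)) ∷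
    ((# 2 , # 3) , (# 3 , # 4) , (# 5 , # 1)) ∷ ((# 1 , # 0) , (# 2 , # 4) , (# 5 , # 2)) ∷ ((# 2 , # 3) , (# 1 , # 1) , (# 0 , # 2)) ∷
    ((# 1 , # 1) , (# 3 , # 0) , (# 4 , # 3)) ∷ ((# 1 , # 0) , (# 4 , # 3) , (# 5 , # 1)) ∷ ((# 0 , # 2) , (# 3 , # 0) , (# 2 , # 4)) ∷
    ((# 0 , # 2) , (# 4 , # 3) , (# 1 , # 4)) ∷
    []

D₄ E₄ : MGDD3 5 4
D₄ = fromBlocks D₄-blocks
E₄ = fromBlocks E₄-blocks

D₆ E₆ : MGDD3 5 6
D₆ = fromBlocks D₆-blocks
E₆ = fromBlocks E₆-blocks

lemma8p3 : DisjointPair 5 4 × DisjointPair 5 6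
lemma8p3 = (D₄ , E₄ , disjoint D₄-blocks E₄-blocks) , (D₆ , E₆ , disjoint D₆-blocks E₆-blocks)
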